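{- Let $\mathbb{C}$ be a small category with set of objects $\mathbb{C}_0$, let $\mathbb{C}_0/{\cong}$ be the set of isomorphism classes of objects, let $s:\mathbb{C}_0/{\cong}\to\mathbb{C}_0$ be a section of the quotient map, and let $T'=(\mathbb{C}_0/{\cong},\,s)\in\mathbf{Fam}(\mathbb{C})$. If $T'$ is a split generic object for the family fibration $p:\mathbf{Fam}(\mathbb{C})\to\mathbf{Set}$ with respect to its canonical splitting, then $\mathbb{C}$ is skeletal, i.e. any two isomorphic objects of $\mathbb{C}$ are equal.
   Context: $\mathbf{Fam}(\mathbb{C})$ has objects pairs $(I,c)$ with $I$ a set and $c:I\to\mathbb{C}_0$; a morphism $(J,d)\to(I,c)$ is a function $u:J\to I$ with, for each $j\in J$, a morphism $d(j)\to c(u(j))$ in $\mathbb{C}$; $p(I,c)=I$. The canonical splitting assigns to $u:J\to I$ and $(I,c)$ the reindexed object $u^*(I,c)=(J,c\circ u)$ with cartesian lift $(u,(\mathrm{id}_{c(u(j))})_{j\in J})$. An object $T$ is a split generic object (with respect to this splitting) if for every object $X$ there is a unique function $u:pX\to pT$ with $u^*T=X$. -}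

module Defs where

open import Data.Product using (Σ; ∃; _×_; _,_)
open import Relation.Binary.PropositionalEquality using (_≡_)

record Category : Set₁ where
  field
    Obj  : Set
    Hom  : Obj → Obj → Set
    idC  : ∀ {a} → Hom a a
    _∘_  : ∀ {a b c} → Hom b c → Hom a b → Hom a c
    idˡ  : ∀ {a b} (f : Hom a b) → idC ∘ f ≡ f
    idʳ  : ∀ {a b} (f : Hom a b) → f ∘ idC ≡ f
    assoc : ∀ {a b c d} (h : Hom c d) (g : Hom b c) (f : Hom a b) →
            (h ∘ g) ∘ f ≡ h ∘ (g ∘ f)

module _ (C : Category) where
  open Category C

  _≅_ : Obj → Obj → Set
  a ≅ b = Σ (Hom a b) λ f → Σ (Hom b a) λ g → (g ∘ f ≡ idC) × (f ∘ g ≡ idC)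

  Skeletal : Set
  Skeletal = ∀ a b → a ≅ b → a ≡ b

  -- The quotient C₀/≅ with its quotient map, characterised (since Agda has
  -- no quotient types) as a set Q with a surjection whose kernel is exactly ≅.
  record IsoClasses : Set₁ where
    field
      Q        : Set
      [_]      : Obj → Q
      sound    : ∀ a b → a ≅ b → [ a ] ≡ [ b ]
      effective : ∀ a b → [ a ] ≡ [ b ] → a ≅ b
      surj     : ∀ x → ∃ λ a → [ a ] ≡ x

  record FamObj : Set₁ where
    constructor fam
    field
      Idx : Set
      obj : Idx → Obj
  open FamObj public

  p : FamObj → Set
  p = Idx

  reindex : ∀ {J} (T : FamObj) → (J → Idx T) → FamObj
  reindex {J} T u = fam J (λ j → obj T (u j))

  ReindexEq : (T X : FamObj) → (p X → p T) → Set
  ReindexEq T X u = ∀ j → obj (reindex T u) j ≡ obj X j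

  -- T is a split generic object w.r.t. the canonical splitting:
  -- for every X there is a unique u : pX → pT with u*T = X
  -- (uniqueness of functions taken pointwise).
  SplitGeneric : FamObj → Set₁
  SplitGeneric T = ∀ (X : FamObj) →
    Σ (p X → p T) λ u → ReindexEq T X u ×
      (∀ (v : p X → p T) → ReindexEq T X v → ∀ j → v j ≡ u j)

{-# OPTIONS --safe #-}
module Submission where

open import Defs
open import Data.Product using (Σ; _,_; proj₁; proj₂)
open import Relation.Binary.PropositionalEquality
  using (_≡_; refl; sym; cong; module ≡-Reasoning)

-- A split generic object T classifies the tautological family (C₀ , id), so
-- every object of C occurs in T. For T′ = (C₀/≅ , s) this makes s surjective;
-- being a section of the quotient map, s is then inverse to it, so the
-- quotient map is injective and isomorphic objects are equal.

module _ (C : Category) where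
  open Category C using (Obj)

  tautological : FamObj C
  tautological = fam Obj (λ a → a)

  splitGeneric⇒obj-surjective : ∀ {T} → SplitGeneric C T →
                                ∀ a → Σ (Idx T) λ i → obj T i ≡ a
  splitGeneric⇒obj-surjective G a = proj₁ (G tautological) a , proj₁ (proj₂ (G tautological)) a

  module _ (K : IsoClasses C) (s : IsoClasses.Q K → Obj)
           (section : ∀ x → IsoClasses.[_] K (s x) ≡ x) where
    open IsoClasses K

    section-surjective⇒retraction : (∀ a → Σ Q λ x → s x ≡ a) →
                                    ∀ a → s [ a ] ≡ a
    section-surjective⇒retraction surj a with surj a
    ... | x , refl = cong s (section x)

    section-surjective⇒skeletal : (∀ a → Σ Q λ x → s x ≡ a) → Skeletal C
    section-surjective⇒skeletal surj a b a≅b = begin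
      a         ≡⟨ sym (retraction a) ⟩
      s [ a ]   ≡⟨ cong s (sound a b a≅b) ⟩
      s [ b ]   ≡⟨ retraction b ⟩
      b         ∎
      where
      open ≡-Reasoning
      retraction = section-surjective⇒retraction surj

mainTheorem3 : (C : Category) (K : IsoClasses C) →
    (s : IsoClasses.Q K → Category.Obj C) →
    (∀ x → IsoClasses.[_] K (s x) ≡ x) →
    SplitGeneric C (fam (IsoClasses.Q K) s) →
    Skeletal C
mainTheorem3 C K s section G =
  section-surjective⇒skeletal C K s section (splitGeneric⇒obj-surjective C G)
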